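{- Let $G$ be a finite directed graph, $C$ a cycle of $G$, and $w\in\mathcal L(G\setminus HE(C))$. Then there exists a subset $E''\subsetneq HE(C)$ such that $w\in\mathcal L(G\setminus E'')$.
   Context: A graph $G$ has finite vertex set $V_G$ and edge set $E_G\subset V_G\times V_G$; for $e=(u,v)$, $\alpha(e)=u$, $\omega(e)=v$, $\overline e=(v,u)$. A linear extension of $G$ is a total order on $V_G$ with $\alpha(e)$ before $\omega(e)$ for every $e\in E_G$; $\mathcal L(G)$ is their set. A cycle is a sequence $(e_1,\dots,e_k)$ of elements of $E_G\cup\{\overline e:e\in E_G\}$ with $\omega(e_i)=\alpha(e_{i+1})$ for $i<k$, $\omega(e_k)=\alpha(e_1)$, all $e_i$ distinct and all visited vertices distinct; $HE(C)$ is the set of those $e_i$ belonging to $E_G$. For $E'\subset E_G$, $G\setminus E'$ has vertex set $V_G$ and edge set $E_G\setminus E'$. -}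

module Defs where

open import Level using (0ℓ)
open import Data.Nat using (ℕ; zero; suc; _≤_)
open import Data.Fin using (Fin; toℕ; _<_)
open import Data.Fin.Permutation using (Permutation′; _⟨$⟩ʳ_)
open import Data.Product using (_×_; _,_; proj₁; proj₂; ∃; swap)
open import Data.Sum using (_⊎_)
open import Relation.Binary.PropositionalEquality using (_≡_; _≢_)
open import Relation.Nullary using (¬_)
open import Relation.Unary using (Pred)

Edge : ℕ → Set
Edge n = Fin n × Fin n

EdgeSet : ℕ → Set₁
EdgeSet n = Pred (Edge n) 0ℓ

α : ∀ {n} → Edge n → Fin n
α = proj₁

ω : ∀ {n} → Edge n → Fin n
ω = proj₂

rev : ∀ {n} → Edge n → Edge n
rev = swap

_∖_ : ∀ {n} → EdgeSet n → EdgeSet n → EdgeSet n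
(E ∖ E') e = E e × ¬ E' e

-- A total order on V = Fin n, given by the rank (position) of each vertex.
TotalOrder : ℕ → Set
TotalOrder n = Permutation′ n

Before : ∀ {n} → TotalOrder n → Fin n → Fin n → Set
Before w u v = (w ⟨$⟩ʳ u) < (w ⟨$⟩ʳ v)

IsLinExt : ∀ {n} → EdgeSet n → TotalOrder n → Set
IsLinExt E w = ∀ e → E e → Before w (α e) (ω e)

CycSucc : (k : ℕ) → Fin k → Fin k → Set
CycSucc k i j = (suc (toℕ i) ≡ toℕ j) ⊎ (suc (toℕ i) ≡ k × toℕ j ≡ 0)

record Cycle {n : ℕ} (E : EdgeSet n) : Set where
  field
    len       : ℕ
    len≥2     : 2 ≤ len
    step      : Fin len → Edge n
    step∈     : ∀ i → E (step i) ⊎ E (rev (step i))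
    closed    : ∀ i j → CycSucc len i j → ω (step i) ≡ α (step j)
    stepInj   : ∀ i j → step i ≡ step j → i ≡ j
    vertInj   : ∀ i j → α (step i) ≡ α (step j) → i ≡ j
    -- a step traversing an edge backwards does not reuse an edge used by another step
    undDistinct : ∀ i j → ¬ E (step i) → rev (step i) ≢ step j

HE : ∀ {n} {E : EdgeSet n} → Cycle E → EdgeSet n
HE {E = E} C e = E e × ∃ λ i → Cycle.step C i ≡ e

_⊆ₑ_ : ∀ {n} → EdgeSet n → EdgeSet n → Set
A ⊆ₑ B = ∀ e → A e → B e

_⊊ₑ_ : ∀ {n} → EdgeSet n → EdgeSet n → Set
A ⊊ₑ B = (A ⊆ₑ B) × (∃ λ e → B e × ¬ A e)

-- Let w be a linear extension of G ∖ HE(C).  Rank the vertices by their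
-- position in w.  Two cases, decided by searching the finitely many steps
-- of C:
--
--  * Some forward step e of C (an edge of G) already goes up in w.  Then w
--    also respects e, so we may put e back: E'' = HE(C) ∖ {e} works, and it
--    is a proper subset of HE(C) because it misses e.
--
--  * No forward step goes up.  Then no step goes up at all: a backward step
--    traverses an edge of G ∖ HE(C) in reverse, which w orders upwards.  So
--    the rank of the starting vertex is non-increasing along the cycle, and a
--    cyclically non-increasing function is constant.  But a cycle has at
--    least two distinct vertices, which get distinct ranks — contradiction.
module Submission where

open import Defs
open import Data.Nat using (ℕ; zero; suc; s≤s) renaming (_≤_ to _≤ℕ_; _≤?_ to _≤?ℕ_)
open import Data.Nat.Properties using (≤-refl; ≤-trans; ≤-antisym; <⇒≤; ≰⇒>)
open import Data.Fin using (Fin; zero; suc; toℕ; fromℕ; inject₁; _<?_)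
open import Data.Fin.Properties using (toℕ-injective; toℕ-inject₁; toℕ-fromℕ; any?; _≟_)
open import Data.Fin.Induction using (<-weakInduction; >-weakInduction)
open import Data.Fin.Permutation using (_⟨$⟩ʳ_)
open import Data.Product using (_×_; ∃; _,_; proj₁; proj₂)
open import Data.Product.Properties using (≡-dec)
open import Data.Sum using (inj₁; inj₂; fromInj₂)
open import Data.Empty using (⊥-elim)
open import Function using (_∘_)
open import Function.Bundles using (Injection)
open import Function.Properties.Inverse using (↔⇒↣)
open import Relation.Nullary using (¬_; yes; no)
open import Relation.Nullary.Decidable using (_×-dec_)
open import Relation.Unary using (Decidable)
open import Relation.Binary.PropositionalEquality using (_≡_; refl; sym; trans; cong; subst)

CyclicallyNonIncreasing : (k : ℕ) → (Fin k → ℕ) → Set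
CyclicallyNonIncreasing k r = ∀ i j → CycSucc k i j → r j ≤ℕ r i

succ-inject₁ : ∀ {m} (i : Fin m) → CycSucc (suc m) (inject₁ i) (suc i)
succ-inject₁ i = inj₁ (cong suc (toℕ-inject₁ i))

succ-last : ∀ m → CycSucc (suc m) (fromℕ m) zero
succ-last m = inj₂ (cong suc (toℕ-fromℕ m) , refl)

-- Going once around the cycle returns to the start, so all the
-- inequalities are equalities: r is constant.
cyclicallyNonIncreasing⇒constant : ∀ k (r : Fin k → ℕ) →
  CyclicallyNonIncreasing k r → ∀ i j → r i ≡ r j
cyclicallyNonIncreasing⇒constant (suc m) r nonInc i j =
  trans (equalsFirst i) (sym (equalsFirst j))
  where
    belowFirst : ∀ i → r i ≤ℕ r zero
    belowFirst = <-weakInduction (λ i → r i ≤ℕ r zero) ≤-refl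
      (λ i ih → ≤-trans (nonInc (inject₁ i) (suc i) (succ-inject₁ i)) ih)

    aboveLast : ∀ i → r (fromℕ m) ≤ℕ r i
    aboveLast = >-weakInduction (λ i → r (fromℕ m) ≤ℕ r i) ≤-refl
      (λ i ih → ≤-trans ih (nonInc (inject₁ i) (suc i) (succ-inject₁ i)))

    equalsFirst : ∀ i → r i ≡ r zero
    equalsFirst i = ≤-antisym (belowFirst i)
      (≤-trans (nonInc (fromℕ m) zero (succ-last m)) (aboveLast i))

twoIndicesDiffer : ∀ {k} → 2 ≤ℕ k → ¬ (∀ (i j : Fin k) → i ≡ j)
twoIndicesDiffer (s≤s (s≤s _)) allEqual with allEqual zero (suc zero)
... | ()

rank : ∀ {n} → TotalOrder n → Fin n → ℕ
rank w v = toℕ (w ⟨$⟩ʳ v)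

rank-injective : ∀ {n} (w : TotalOrder n) {u v} → rank w u ≡ rank w v → u ≡ v
rank-injective w eq = Injection.injective (↔⇒↣ w) (toℕ-injective eq)

restoreRespectedEdge : ∀ {n} (E H : EdgeSet n) (w : TotalOrder n) (e : Edge n) →
  IsLinExt (E ∖ H) w → Before w (α e) (ω e) → IsLinExt (E ∖ (H ∖ (_≡ e))) w
restoreRespectedEdge E H w e lin e-up x (Ex , x∉H∖e) with ≡-dec _≟_ _≟_ x e
... | yes refl = e-up
... | no  x≢e  = lin x (Ex , λ x∈H → x∉H∖e (x∈H , x≢e))

dropMember-⊊ : ∀ {n} (H : EdgeSet n) {e} → H e → (H ∖ (_≡ e)) ⊊ₑ H
dropMember-⊊ H e∈H = (λ _ → proj₁) , _ , e∈H , λ e∈H∖e → proj₂ e∈H∖e refl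

AscendingForwardStep : ∀ {n} {E : EdgeSet n} (C : Cycle E) (w : TotalOrder n) →
  Fin (Cycle.len C) → Set
AscendingForwardStep {n} {E} C w i = E e × Before w (α e) (ω e)
  where
    e : Edge n
    e = Cycle.step C i

module _ {n} {E : EdgeSet n} (C : Cycle E) (w : TotalOrder n)
         (lin : IsLinExt (E ∖ HE C) w) where
  open Cycle C

  -- If no forward step goes up, every step goes weakly down: a step going
  -- strictly up is not an edge of G, so it reverses an edge outside HE(C),
  -- which w orders upwards — i.e. the step goes down after all.
  stepDescends : (∀ i → ¬ AscendingForwardStep C w i) →
    ∀ i → rank w (ω (step i)) ≤ℕ rank w (α (step i))
  stepDescends noneUp i with rank w (ω (step i)) ≤?ℕ rank w (α (step i))
  ... | yes down = down
  ... | no notDown = ⊥-elim (notDown (<⇒≤ (lin (rev (step i)) (reversed , reverseNotInHE))))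
    where
      notForward : ¬ E (step i)
      notForward forward = noneUp i (forward , ≰⇒> notDown)

      reversed : E (rev (step i))
      reversed = fromInj₂ (⊥-elim ∘ notForward) (step∈ i)

      reverseNotInHE : ¬ HE C (rev (step i))
      reverseNotInHE (_ , j , stepj≡rev) = undDistinct i j notForward (sym stepj≡rev)

  someForwardStepAscends : ¬ (∀ i → ¬ AscendingForwardStep C w i)
  someForwardStepAscends noneUp =
    twoIndicesDiffer len≥2 λ i j → vertInj i j (rank-injective w (constant i j))
    where
      r : Fin len → ℕ
      r i = rank w (α (step i))

      nonInc : CyclicallyNonIncreasing len r
      nonInc i j i→j = subst (λ v → rank w v ≤ℕ r i) (closed i j i→j) (stepDescends noneUp i)

      constant : ∀ i j → r i ≡ r j
      constant = cyclicallyNonIncreasing⇒constant len r nonInc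

mainTheorem10 : (n : ℕ) (E : EdgeSet n) → Decidable E → (C : Cycle E) (w : TotalOrder n) →
    IsLinExt (E ∖ HE C) w →
    ∃ λ (E'' : EdgeSet n) → (E'' ⊊ₑ HE C) × IsLinExt (E ∖ E'') w
mainTheorem10 n E E? C w lin with any? ascendingForwardStep?
  where
    open Cycle C
    ascendingForwardStep? : Decidable (AscendingForwardStep C w)
    ascendingForwardStep? i = E? (step i) ×-dec (w ⟨$⟩ʳ α (step i) <? w ⟨$⟩ʳ ω (step i))
... | yes (i , forward , up) =
  HE C ∖ (_≡ e) , dropMember-⊊ (HE C) (forward , i , refl) , restoreRespectedEdge E (HE C) w e lin up
  where
    e : Edge n
    e = Cycle.step C i
... | no noneUp = ⊥-elim (someForwardStepAscends C w lin (λ i up → noneUp (i , up)))
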